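{- Let $\mu$ be a strictly nonzero $\mathbb{Z}$-valued charge on a Boolean algebra $\mathcal{A}$ of subsets of a set $X$. Suppose that $\{A_i : i\in\mathbb{N}\}$ is an infinite family of pairwise disjoint nonempty sets in $\mathcal{A}$ such that $\mu(A_i)=a$ for all $i$, for some integer $a$. Then there is a Boolean algebra $\mathcal{B}\supseteq\mathcal{A}$ of subsets of $X$ such that $\mu$ cannot be extended to a strictly nonzero $\mathbb{Z}$-valued charge on $\mathcal{B}$.
   Context: A $\mathbb{Z}$-valued charge on a Boolean algebra $\mathcal{A}$ of sets is a finitely additive map $\mu:\mathcal{A}\to\mathbb{Z}$, i.e. $\mu(U\cup V)=\mu(U)+\mu(V)$ for disjoint $U,V\in\mathcal{A}$. It is strictly nonzero if $\mu(U)=0$ only when $U=\emptyset$. An extension of $\mu$ to $\mathcal{B}\supseteq\mathcal{A}$ is a charge on $\mathcal{B}$ agreeing with $\mu$ on $\mathcal{A}$. -}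

module Defs where

open import Level using (0ℓ)
open import Data.Nat using (ℕ)
open import Data.Integer using (ℤ; 0ℤ)
open import Data.Product using (Σ; _×_)
open import Relation.Binary.PropositionalEquality using (_≡_; _≢_)
open import Relation.Unary using (Pred; ∅; ∁; _∪_; _≐_; _⊥_; _⊆_; Satisfiable; Empty)

Subset : Set → Set₁
Subset X = Pred X 0ℓ

Family : Set → Set₂
Family X = Subset X → Set₁

-- A Boolean algebra of subsets of X: contains ∅, closed under complement
-- and binary union, and (since it is a family of *sets*) closed under
-- extensional equality of subsets.
record IsBooleanAlgebra {X : Set} (𝒜 : Family X) : Set₂ where
  field
    has-∅     : 𝒜 ∅
    closed-∁  : ∀ {U} → 𝒜 U → 𝒜 (∁ U)
    closed-∪  : ∀ {U V} → 𝒜 U → 𝒜 V → 𝒜 (U ∪ V)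
    closed-≐  : ∀ {U V} → U ≐ V → 𝒜 U → 𝒜 V

-- A ℤ-valued charge on 𝒜: a map on the members of 𝒜 (given as a function on
-- all subsets whose values off 𝒜 are irrelevant) which is a function of the
-- set (respects extensional equality) and is finitely additive.
record IsCharge {X : Set} (𝒜 : Family X) (μ : Subset X → ℤ) : Set₂ where
  field
    respects-≐ : ∀ {U V} → 𝒜 U → 𝒜 V → U ≐ V → μ U ≡ μ V
    additive   : ∀ {U V} → 𝒜 U → 𝒜 V → U ⊥ V →
                 μ (U ∪ V) ≡ μ U Data.Integer.+ μ V

StrictlyNonzero : {X : Set} (𝒜 : Family X) (μ : Subset X → ℤ) → Set₁
StrictlyNonzero 𝒜 μ = ∀ {U} → 𝒜 U → μ U ≡ 0ℤ → U ≐ ∅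

_⊑_ : {X : Set} → Family X → Family X → Set₁
𝒜 ⊑ ℬ = ∀ {U} → 𝒜 U → ℬ U

IsExtension : {X : Set} (𝒜 ℬ : Family X) (μ ν : Subset X → ℤ) → Set₂
IsExtension 𝒜 ℬ μ ν = IsCharge ℬ ν × (∀ {U} → 𝒜 U → ν U ≡ μ U)

module Submission where

open import Defs
open import Data.Nat using (ℕ)
open import Data.Integer using (ℤ)
open import Data.Product using (Σ; _×_)
open import Relation.Nullary using (¬_)
open import Relation.Binary.PropositionalEquality using (_≡_; _≢_)
open import Relation.Unary using (_⊥_; Satisfiable)

open import Level using (Lift; lift; 0ℓ)
import Level
open import Data.Unit using (⊤; tt)
import Data.Empty as Empty
open import Data.Sum using (inj₁; inj₂; [_,_])
open import Data.Product using (_,_; proj₁; ∃; ∃₂)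
import Data.Nat as ℕ
open import Data.Nat using (suc; _≤_; _<_; _%_; _⊔_; _≟_; _<?_)
open import Data.Nat.Properties
  using (≤-trans; <-trans; <-irrefl; <⇒≢; <⇒≱; ≤-pred; n<1+n; m≤m*n; m≤n+m; m⊔n≤o⇒m≤o; m⊔n≤o⇒n≤o)
open import Data.Nat.DivMod using ([m+kn]%n≡m%n; m<n⇒m%n≡m)
open import Data.Integer using (+_; -[1+_]; _+_; _-_; _*_; -_; ∣_∣; 0ℤ; NonZero; ≢-nonZero)
open import Data.Integer.Properties
  using (+-comm; +-assoc; +-identityʳ; suc-*; +-inverseˡ; +-inverseʳ; neg-distribˡ-*; neg-distribʳ-*)
open import Data.Integer.DivMod using (_/_; n%d<d; a≡a%n+[a/n]*n)
import Data.Integer.DivMod as ℤ using (_%_)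
open import Data.Integer.Tactic.RingSolver using (solve-∀)
open import Data.Fin using (toℕ; fromℕ<)
open import Data.Fin.Properties using (pigeonhole; fromℕ<-injective; toℕ<n)
open import Relation.Binary.PropositionalEquality
  using (refl; sym; trans; cong; cong₂; subst; module ≡-Reasoning)
open import Relation.Nullary using (yes; no)
open import Relation.Unary using (Pred; Decidable; ∁; _∪_; _∩_; _⊆_; _≐_; ｛_｝)

-- Take ℬ to be the whole power set, and suppose ν is a strictly nonzero
-- charge on it extending μ. For an infinite, coinfinite index set T, the
-- value ν(⋃_{i∈T} A_i) can be shifted by +a (add an index outside T) or by
-- -a (remove an index of T) without T ceasing to be infinite and coinfinite,
-- so no such value is a multiple of a: shifting it to 0 would make a
-- nonempty set null. Yet among the |a| + 1 values ν(⋃_{i mod (|a|+1) < p} A_i),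
-- p ≤ |a|, two agree modulo a, and their difference is such a value.
-- (When a = 0, A_0 itself is a nonempty null set.)

i+j≡k⇒j≡k-i : ∀ {i j k} → i + j ≡ k → j ≡ k - i
i+j≡k⇒j≡k-i {i} {j} refl = j≡[i+j]-i i j
  where
  j≡[i+j]-i : ∀ i j → j ≡ (i + j) - i
  j≡[i+j]-i = solve-∀

x%a≡y%a⇒y-x≡[y/a-x/a]*a : ∀ x y a .{{_ : NonZero a}} →
                          x ℤ.% a ≡ y ℤ.% a → y - x ≡ (y / a - x / a) * a
x%a≡y%a⇒y-x≡[y/a-x/a]*a x y a x%a≡y%a = begin
  y - x
    ≡⟨ cong₂ _-_ (a≡a%n+[a/n]*n y a) (a≡a%n+[a/n]*n x a) ⟩
  (+ (y ℤ.% a) + y / a * a) - (+ (x ℤ.% a) + x / a * a)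
    ≡⟨ cong (λ r → (+ (y ℤ.% a) + y / a * a) - (+ r + x / a * a)) x%a≡y%a ⟩
  (+ (y ℤ.% a) + y / a * a) - (+ (y ℤ.% a) + x / a * a)
    ≡⟨ cancel (+ (y ℤ.% a)) (y / a) (x / a) a ⟩
  (y / a - x / a) * a ∎
  where
  open ≡-Reasoning
  cancel : ∀ r q q′ a → (r + q * a) - (r + q′ * a) ≡ (q - q′) * a
  cancel = solve-∀

pigeonhole-% : ∀ a .{{_ : NonZero a}} (f : ℕ → ℤ) →
               ∃₂ λ p q → p < q × q ≤ ∣ a ∣ × ∃ λ k → f q - f p ≡ k * a
pigeonhole-% a f
  with i , j , i<j , same ← pigeonhole (n<1+n ∣ a ∣) (λ p → fromℕ< (n%d<d (f (toℕ p)) a))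
  = toℕ i , toℕ j , i<j , ≤-pred (toℕ<n j) , f (toℕ j) / a - f (toℕ i) / a
  , x%a≡y%a⇒y-x≡[y/a-x/a]*a (f (toℕ i)) (f (toℕ j)) a (fromℕ<-injective _ _ _ _ same)

≐-∪-∩∁ : ∀ {I : Set} {S T : Pred I 0ℓ} → Decidable S → S ⊆ T → T ≐ S ∪ (T ∩ ∁ S)
≐-∪-∩∁ {S = S} {T} S? S⊆T = split , [ S⊆T , proj₁ ]
  where
  split : T ⊆ S ∪ (T ∩ ∁ S)
  split {i} Ti with S? i
  ... | yes Si = inj₁ Si
  ... | no ¬Si = inj₂ (Ti , ¬Si)

Infinite : Pred ℕ 0ℓ → Set
Infinite T = ∀ n → ∃ λ t → n ≤ t × T t

Coinfinite : Pred ℕ 0ℓ → Set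
Coinfinite T = Infinite (∁ T)

Infinite-mono : ∀ {S T} → S ⊆ T → Infinite S → Infinite T
Infinite-mono S⊆T S-inf n with t , n≤t , St ← S-inf n = t , n≤t , S⊆T St

Infinite-∖ : ∀ {T} t → Infinite T → Infinite (T ∩ ∁ ｛ t ｝)
Infinite-∖ t T-inf n with s , n⊔1+t≤s , Ts ← T-inf (n ⊔ suc t) =
  s , m⊔n≤o⇒m≤o n (suc t) n⊔1+t≤s , Ts , <⇒≢ (m⊔n≤o⇒n≤o n (suc t) n⊔1+t≤s)

Infinite-%≡ : ∀ M .{{_ : ℕ.NonZero M}} {r} → r < M → Infinite (λ i → i % M ≡ r)
Infinite-%≡ M {r} r<M n =
  r ℕ.+ n ℕ.* M , ≤-trans (m≤m*n n M) (m≤n+m (n ℕ.* M) r) ,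
  trans ([m+kn]%n≡m%n r n M) (m<n⇒m%n≡m r<M)

module IndexedUnion {X : Set} (A : ℕ → Subset X) where

  ⋃[_] : Pred ℕ 0ℓ → Subset X
  ⋃[ T ] x = ∃ λ i → T i × A i x

  ⋃-mono : ∀ {S T} → S ⊆ T → ⋃[ S ] ⊆ ⋃[ T ]
  ⋃-mono S⊆T (i , Si , Aix) = i , S⊆T Si , Aix

  ⋃-cong : ∀ {S T} → S ≐ T → ⋃[ S ] ≐ ⋃[ T ]
  ⋃-cong (S⊆T , T⊆S) = ⋃-mono S⊆T , ⋃-mono T⊆S

  ⋃-∪ : ∀ {S T} → ⋃[ S ∪ T ] ≐ ⋃[ S ] ∪ ⋃[ T ]
  ⋃-∪ = (λ { (i , inj₁ Si , Aix) → inj₁ (i , Si , Aix)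
           ; (i , inj₂ Ti , Aix) → inj₂ (i , Ti , Aix) })
      , [ ⋃-mono inj₁ , ⋃-mono inj₂ ]

  ⋃-｛｝ : ∀ {t} → ⋃[ ｛ t ｝ ] ≐ A t
  ⋃-｛｝ = (λ { (_ , refl , Atx) → Atx }) , λ Atx → _ , refl , Atx

  ⋃-disjoint : (∀ i j → i ≢ j → A i ⊥ A j) → ∀ {S T} → S ⊥ T → ⋃[ S ] ⊥ ⋃[ T ]
  ⋃-disjoint disjoint S⊥T ((i , Si , Aix) , (j , Tj , Ajx)) with i ≟ j
  ... | yes refl = S⊥T (Si , Tj)
  ... | no i≢j = disjoint i j i≢j (Aix , Ajx)

𝒫 : (X : Set) → Family X
𝒫 X _ = Lift (Level.suc 0ℓ) ⊤

𝒫-isBooleanAlgebra : ∀ {X} → IsBooleanAlgebra (𝒫 X)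
𝒫-isBooleanAlgebra = record
  { has-∅ = lift tt ; closed-∁ = λ _ → lift tt
  ; closed-∪ = λ _ _ → lift tt ; closed-≐ = λ _ _ → lift tt }

module StrictChargeOnPowerset
  {X : Set} {ν : Subset X → ℤ} (charge : IsCharge (𝒫 X) ν) (strict : StrictlyNonzero (𝒫 X) ν)
  (A : ℕ → Subset X) (disjoint : ∀ i j → i ≢ j → A i ⊥ A j) (nonempty : ∀ i → Satisfiable (A i))
  {a : ℤ} (ν-A : ∀ i → ν (A i) ≡ a)
  where

  open IndexedUnion A
  open ≡-Reasoning

  ν-cong : ∀ {U V} → U ≐ V → ν U ≡ ν V
  ν-cong = IsCharge.respects-≐ charge _ _

  ν-⋃-∪ : ∀ {S T} → S ⊥ T → ν ⋃[ S ∪ T ] ≡ ν ⋃[ S ] + ν ⋃[ T ]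
  ν-⋃-∪ S⊥T = trans (ν-cong ⋃-∪) (IsCharge.additive charge _ _ (⋃-disjoint disjoint S⊥T))

  ν-⋃-insert : ∀ {T t} → ¬ T t → ν ⋃[ ｛ t ｝ ∪ T ] ≡ a + ν ⋃[ T ]
  ν-⋃-insert {T} {t} ¬Tt = begin
    ν ⋃[ ｛ t ｝ ∪ T ]        ≡⟨ ν-⋃-∪ (λ { (refl , Tt) → ¬Tt Tt }) ⟩
    ν ⋃[ ｛ t ｝ ] + ν ⋃[ T ]  ≡⟨ cong (_+ ν ⋃[ T ]) (trans (ν-cong ⋃-｛｝) (ν-A t)) ⟩
    a + ν ⋃[ T ]             ∎

  ν-⋃-remove : ∀ {T t} → T t → ν ⋃[ T ] ≡ a + ν ⋃[ T ∩ ∁ ｛ t ｝ ]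
  ν-⋃-remove {T} {t} Tt = begin
    ν ⋃[ T ]                             ≡⟨ ν-cong (⋃-cong (≐-∪-∩∁ (t ≟_) λ { refl → Tt })) ⟩
    ν ⋃[ ｛ t ｝ ∪ (T ∩ ∁ ｛ t ｝) ]        ≡⟨ ν-⋃-insert (λ (_ , t≢t) → t≢t refl) ⟩
    a + ν ⋃[ T ∩ ∁ ｛ t ｝ ]              ∎

  Attained : ℤ → Set₁
  Attained v = ∃ λ T → Infinite T × Coinfinite T × ν ⋃[ T ] ≡ v

  ¬Attained-0 : ¬ Attained 0ℤ
  ¬Attained-0 (T , T-inf , _ , ν⋃T≡0) with t , _ , Tt ← T-inf 0 with x , Atx ← nonempty t =
    proj₁ (strict _ ν⋃T≡0) (t , Tt , Atx)

  Attained-+ : ∀ {v} → Attained v → Attained (v + a)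
  Attained-+ {v} (T , T-inf , T-coinf , ν⋃T≡v) with t , _ , ¬Tt ← T-coinf 0 =
    ｛ t ｝ ∪ T ,
    Infinite-mono inj₂ T-inf ,
    Infinite-mono (λ (¬Ti , t≢i) → [ t≢i , ¬Ti ]) (Infinite-∖ t T-coinf) ,
    (begin
      ν ⋃[ ｛ t ｝ ∪ T ]  ≡⟨ ν-⋃-insert ¬Tt ⟩
      a + ν ⋃[ T ]       ≡⟨ cong (λ w → a + w) ν⋃T≡v ⟩
      a + v              ≡⟨ +-comm a v ⟩
      v + a              ∎)

  Attained-− : ∀ {v} → Attained v → Attained (v - a)
  Attained-− {v} (T , T-inf , T-coinf , ν⋃T≡v) with t , _ , Tt ← T-inf 0 =
    T ∩ ∁ ｛ t ｝ ,
    Infinite-∖ t T-inf ,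
    Infinite-mono (λ ¬Ti (Ti , _) → ¬Ti Ti) T-coinf ,
    i+j≡k⇒j≡k-i (trans (sym (ν-⋃-remove Tt)) ν⋃T≡v)

  Attained-iterate : ∀ {b} → (∀ {v} → Attained v → Attained (v + b)) →
                     ∀ n {v} → Attained v → Attained (v + + n * b)
  Attained-iterate step ℕ.zero {v} att = subst Attained (sym (+-identityʳ v)) att
  Attained-iterate {b} step (suc n) {v} att =
    subst Attained shift (step (Attained-iterate step n att))
    where
    shift : (v + + n * b) + b ≡ v + + suc n * b
    shift = begin
      (v + + n * b) + b  ≡⟨ +-assoc v (+ n * b) b ⟩
      v + (+ n * b + b)  ≡⟨ cong (λ w → v + w) (+-comm (+ n * b) b) ⟩
      v + (b + + n * b)  ≡⟨ cong (λ w → v + w) (sym (suc-* (+ n) b)) ⟩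
      v + + suc n * b    ∎

  ¬Attained-multiple : ∀ k → ¬ Attained (k * a)
  ¬Attained-multiple (+ n) att = ¬Attained-0 (subst Attained cancels
    (Attained-iterate Attained-− n att))
    where
    cancels : + n * a + + n * - a ≡ 0ℤ
    cancels = trans (cong (λ w → + n * a + w) (sym (neg-distribʳ-* (+ n) a))) (+-inverseʳ (+ n * a))
  ¬Attained-multiple k@(-[1+ n ]) att = ¬Attained-0 (subst Attained cancels
    (Attained-iterate Attained-+ (suc n) att))
    where
    cancels : k * a + + suc n * a ≡ 0ℤ
    cancels = trans (cong (_+ + suc n * a) (sym (neg-distribˡ-* (+ suc n) a))) (+-inverseˡ (+ suc n * a))

  M : ℕ
  M = suc ∣ a ∣

  Residue< : ℕ → Pred ℕ 0ℓ
  Residue< p i = i % M < p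

  Attained-some-multiple : .{{_ : NonZero a}} → ∃ λ k → Attained (k * a)
  Attained-some-multiple
    with p , q , p<q , q≤∣a∣ , k , Λq-Λp≡ka ← pigeonhole-% a (λ p → ν ⋃[ Residue< p ])
    = k , Residue< q ∩ ∁ (Residue< p) , infinite , coinfinite , value
    where
    infinite : Infinite (Residue< q ∩ ∁ (Residue< p))
    infinite = Infinite-mono (λ i%M≡p → subst (_< q) (sym i%M≡p) p<q , <-irrefl i%M≡p)
                             (Infinite-%≡ M (<-trans p<q (ℕ.s≤s q≤∣a∣)))

    coinfinite : Coinfinite (Residue< q ∩ ∁ (Residue< p))
    coinfinite = Infinite-mono
      (λ i%M≡∣a∣ (i%M<q , _) → <⇒≱ i%M<q (subst (q ≤_) (sym i%M≡∣a∣) q≤∣a∣))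
      (Infinite-%≡ M (n<1+n ∣ a ∣))

    value : ν ⋃[ Residue< q ∩ ∁ (Residue< p) ] ≡ k * a
    value = trans (i+j≡k⇒j≡k-i (sym (trans
      (ν-cong (⋃-cong (≐-∪-∩∁ (λ i → i % M <? p) (λ i%M<p → <-trans i%M<p p<q))))
      (ν-⋃-∪ λ (i%M<p , _ , ¬i%M<p) → ¬i%M<p i%M<p)))) Λq-Λp≡ka

  a≢0 : a ≢ 0ℤ
  a≢0 a≡0 with x , A0x ← nonempty 0 = proj₁ (strict _ (trans (ν-A 0) a≡0)) A0x

  inconsistent : Empty.⊥
  inconsistent =
    let instance _ = ≢-nonZero a≢0
        k , att = Attained-some-multiple
    in ¬Attained-multiple k att

theorem5 : (X : Set) (𝒜 : Family X) (μ : Subset X → ℤ) →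
    IsBooleanAlgebra 𝒜 → IsCharge 𝒜 μ → StrictlyNonzero 𝒜 μ →
    (A : ℕ → Subset X) (a : ℤ) →
    (∀ i → 𝒜 (A i)) →
    (∀ i j → i ≢ j → A i ⊥ A j) →
    (∀ i → Satisfiable (A i)) →
    (∀ i → μ (A i) ≡ a) →
    Σ (Family X) λ ℬ →
    IsBooleanAlgebra ℬ × 𝒜 ⊑ ℬ ×
    ¬ (Σ (Subset X → ℤ) λ ν → IsExtension 𝒜 ℬ μ ν × StrictlyNonzero ℬ ν)
theorem5 X 𝒜 μ _ _ _ A a A∈𝒜 disjoint nonempty μ-A =
  𝒫 X , 𝒫-isBooleanAlgebra , (λ _ → lift tt) , λ (ν , (charge , agrees) , strict) →
    StrictChargeOnPowerset.inconsistent charge strict A disjoint nonempty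
      (λ i → trans (agrees (A∈𝒜 i)) (μ-A i))
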